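{- Let $H_1$ and $H_2$ be vertex-disjoint $i$-graph realizable graphs, let $x\in V(H_1)$ and $y\in V(H_2)$. Then the graph $H_{x=y}$ obtained from $H_1\cup H_2$ by identifying $x$ with $y$ is $i$-graph realizable.
   Context: All graphs are finite and simple. For a graph $G$, $i(G)$ denotes the minimum cardinality of an independent dominating set of $G$; an independent dominating set of cardinality $i(G)$ is an $i$-set of $G$. The $i$-graph $\mathcal{I}(G)$ of $G$ is the graph whose vertices are the $i$-sets of $G$, where two $i$-sets $S$ and $S'$ are adjacent if and only if there is an edge $xy\in E(G)$ with $S'=(S-\{x\})\cup\{y\}$. A graph $H$ is $i$-graph realizable (an $i$-graph) if there exists a graph $G$ with $\mathcal{I}(G)\cong H$. -}

module Defs where

open import Data.Nat using (ℕ; suc; _+_; _≤_)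
open import Data.Bool using (Bool; true; false; _∧_)
open import Data.Fin using (Fin; splitAt; punchIn; _≟_)
open import Data.Fin.Subset using (Subset; _∈_; _∉_; ⁅_⁆; _∪_; _─_; ∣_∣)
open import Data.Sum using (_⊎_; inj₁; inj₂)
open import Data.Product using (Σ; ∃; ∃-syntax; _×_; _,_)
open import Relation.Nullary using (¬_; does)
open import Relation.Binary.PropositionalEquality using (_≡_; _≢_)
open import Function.Definitions using (Injective)

Graph : ℕ → Set
Graph n = Fin n → Fin n → Bool

IsSimple : ∀ {n} → Graph n → Set
IsSimple {n} G = (∀ u v → G u v ≡ G v u) × (∀ v → G v v ≡ false)

module _ {n : ℕ} (G : Graph n) where

  Independent : Subset n → Set
  Independent S = ∀ u v → u ∈ S → v ∈ S → G u v ≡ false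

  Dominating : Subset n → Set
  Dominating S = ∀ v → v ∈ S ⊎ (∃[ u ] (u ∈ S × G u v ≡ true))

  IndDom : Subset n → Set
  IndDom S = Independent S × Dominating S

  IsISet : Subset n → Set
  IsISet S = IndDom S × (∀ T → IndDom T → ∣ S ∣ ≤ ∣ T ∣)

  -- adjacency in the i-graph: S' = (S - {x}) ∪ {y} for an edge xy of G
  -- (S ≢ S' since the i-graph is a simple graph).
  ISetAdj : Subset n → Subset n → Set
  ISetAdj S S' = S ≢ S' × ∃[ x ] ∃[ y ] (G x y ≡ true × S' ≡ (S ─ ⁅ x ⁆) ∪ ⁅ y ⁆)

IsoToIGraph : ∀ {m n} → Graph m → Graph n → Set
IsoToIGraph {m} {n} H G =
  Σ (Fin m → Subset n) λ f →
      (∀ v → IsISet G (f v))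
    × Injective _≡_ _≡_ f
    × (∀ S → IsISet G S → ∃[ v ] (f v ≡ S))
    × (∀ u v → (H u v ≡ true → ISetAdj G (f u) (f v))
             × (ISetAdj G (f u) (f v) → H u v ≡ true))

IGraphRealizable : ∀ {m} → Graph m → Set
IGraphRealizable H = ∃[ n ] Σ (Graph n) λ G → IsSimple G × IsoToIGraph H G

-- Vertices: Fin (m + k); the first m are H₁'s vertices
-- (x playing the role of the identified vertex), the last k are the vertices
-- of H₂ other than y, via punchIn y.
identify : ∀ {m k} → Graph m → Graph (suc k) → Fin m → Fin (suc k) → Graph (m + k)
identify {m} {k} H₁ H₂ x y u v = go (splitAt m u) (splitAt m v)
  where
  go : Fin m ⊎ Fin k → Fin m ⊎ Fin k → Bool
  go (inj₁ a) (inj₁ b) = H₁ a b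
  go (inj₂ a) (inj₂ b) = H₂ (punchIn y a) (punchIn y b)
  go (inj₁ a) (inj₂ b) = does (a ≟ x) ∧ H₂ y (punchIn y b)
  go (inj₂ a) (inj₁ b) = does (b ≟ x) ∧ H₂ (punchIn y a) y

{-# OPTIONS --safe #-}
module Submission where

-- Realize H₁ by G₁, with x corresponding to the i-set X, and H₂ by G₂, with y corresponding to
-- the i-set Y.  Glue G₁ and G₂ by joining every vertex of G₁ outside X to every vertex of G₂
-- outside Y.  An independent dominating set T₁ ∪ T₂ of the glued graph either meets V(G₁) − X,
-- which forces T₂ = Y, or lies inside X, which forces T₁ = X.  Hence its i-sets are exactly the
-- sets A₁ ∪ Y and X ∪ A₂ with A₁, A₂ i-sets of G₁, G₂, two of them are adjacent only when they
-- differ on one side, and the two families share exactly one member, X ∪ Y, the image of the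
-- identified vertex.

open import Defs
open import Data.Nat using (ℕ; zero; suc; _+_; _≤_)
open import Data.Nat.Properties using (≤-refl; ≤-trans; +-mono-≤; +-cancelˡ-≤; +-cancelʳ-≤)
open import Data.Bool using (Bool; true; false; not; _∧_)
open import Data.Bool.Properties using (∧-zeroʳ; not-¬)
import Data.Fin as Fin
open import Data.Fin using (Fin; splitAt; join; punchIn; punchOut; _≟_; _↑ˡ_; _↑ʳ_)
open import Data.Fin.Properties
  using (splitAt-↑ˡ; splitAt-↑ʳ; splitAt⁻¹-↑ˡ; splitAt⁻¹-↑ʳ; join-splitAt; punchIn-injective; punchInᵢ≢i; punchIn-punchOut; any?)
open import Data.Fin.Subset using (Subset; inside; outside; _∈_; _∉_; _⊆_; ⊥; ⁅_⁆; _∪_; _─_; ∣_∣)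
open import Data.Fin.Subset.Properties using (_∈?_; ⊆-antisym; p─⊥≡p; p─q⊆p; p⊆p∪q; ∪-identityʳ)
open import Data.Vec using ([]; _∷_; _++_; here; there)
import Data.Vec as Vec
open import Data.Vec.Properties using (zipWith-++; ++-injectiveˡ; ++-injectiveʳ)
open import Data.Sum using (_⊎_; inj₁; inj₂; [_,_]′)
import Data.Sum as Sum
open import Data.Product using (∃-syntax; _×_; _,_; proj₁; proj₂)
import Data.Product as Product
open import Data.Empty using (⊥-elim)
open import Relation.Nullary using (¬_; does; yes; no; ¬?)
open import Relation.Nullary.Decidable using (_×-dec_; dec-true; dec-false; decidable-stable)
open import Relation.Binary.PropositionalEquality
open import Function using (_∘_)

∣++∣ : ∀ {n₁ n₂} (A : Subset n₁) (B : Subset n₂) → ∣ A ++ B ∣ ≡ ∣ A ∣ + ∣ B ∣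
∣++∣ []            B = refl
∣++∣ (inside ∷ A)  B = cong suc (∣++∣ A B)
∣++∣ (outside ∷ A) B = ∣++∣ A B

∣++∣-mono-≤ : ∀ {n₁ n₂} (A₁ B₁ : Subset n₁) (A₂ B₂ : Subset n₂) →
              ∣ A₁ ∣ ≤ ∣ B₁ ∣ → ∣ A₂ ∣ ≤ ∣ B₂ ∣ → ∣ A₁ ++ A₂ ∣ ≤ ∣ B₁ ++ B₂ ∣
∣++∣-mono-≤ A₁ B₁ A₂ B₂ p q = subst₂ _≤_ (sym (∣++∣ A₁ A₂)) (sym (∣++∣ B₁ B₂)) (+-mono-≤ p q)

∣++∣-cancelʳ-≤ : ∀ {n₁ n₂} (A B : Subset n₁) (C : Subset n₂) → ∣ A ++ C ∣ ≤ ∣ B ++ C ∣ → ∣ A ∣ ≤ ∣ B ∣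
∣++∣-cancelʳ-≤ A B C p = +-cancelʳ-≤ (∣ C ∣) (∣ A ∣) (∣ B ∣) (subst₂ _≤_ (∣++∣ A C) (∣++∣ B C) p)

∣++∣-cancelˡ-≤ : ∀ {n₁ n₂} (C : Subset n₁) (A B : Subset n₂) → ∣ C ++ A ∣ ≤ ∣ C ++ B ∣ → ∣ A ∣ ≤ ∣ B ∣
∣++∣-cancelˡ-≤ C A B p = +-cancelˡ-≤ (∣ C ∣) (∣ A ∣) (∣ B ∣) (subst₂ _≤_ (∣++∣ C A) (∣++∣ C B) p)

∈-++⁺ˡ : ∀ {n₁ n₂} {A : Subset n₁} {B : Subset n₂} {a} → a ∈ A → (a ↑ˡ n₂) ∈ A ++ B
∈-++⁺ˡ here      = here
∈-++⁺ˡ (there p) = there (∈-++⁺ˡ p)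

∈-++⁻ˡ : ∀ {n₁ n₂} {A : Subset n₁} {B : Subset n₂} {a} → (a ↑ˡ n₂) ∈ A ++ B → a ∈ A
∈-++⁻ˡ {A = _ ∷ _} {a = Fin.zero}  here      = here
∈-++⁻ˡ {A = _ ∷ _} {a = Fin.suc a} (there p) = there (∈-++⁻ˡ p)

∈-++⁺ʳ : ∀ {n₁ n₂} {A : Subset n₁} {B : Subset n₂} {c} → c ∈ B → (n₁ ↑ʳ c) ∈ A ++ B
∈-++⁺ʳ {A = []}    p = p
∈-++⁺ʳ {A = _ ∷ A} p = there (∈-++⁺ʳ {A = A} p)

∈-++⁻ʳ : ∀ {n₁ n₂} {A : Subset n₁} {B : Subset n₂} {c} → (n₁ ↑ʳ c) ∈ A ++ B → c ∈ B
∈-++⁻ʳ {A = []}    p         = p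
∈-++⁻ʳ {A = _ ∷ A} (there p) = ∈-++⁻ʳ {A = A} p

⊥++⊥ : ∀ n₁ {n₂} → ⊥ {n₁} ++ ⊥ {n₂} ≡ ⊥
⊥++⊥ zero     = refl
⊥++⊥ (suc n₁) = cong (outside ∷_) (⊥++⊥ n₁)

⁅↑ˡ⁆ : ∀ {n₁} (a : Fin n₁) n₂ → ⁅ a ↑ˡ n₂ ⁆ ≡ ⁅ a ⁆ ++ ⊥
⁅↑ˡ⁆ {suc n₁} Fin.zero    n₂ = cong (inside ∷_) (sym (⊥++⊥ n₁))
⁅↑ˡ⁆          (Fin.suc a) n₂ = cong (outside ∷_) (⁅↑ˡ⁆ a n₂)

⁅↑ʳ⁆ : ∀ n₁ {n₂} (c : Fin n₂) → ⁅ n₁ ↑ʳ c ⁆ ≡ ⊥ ++ ⁅ c ⁆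
⁅↑ʳ⁆ zero     c = refl
⁅↑ʳ⁆ (suc n₁) c = cong (outside ∷_) (⁅↑ʳ⁆ n₁ c)

─∪-++ : ∀ {n₁ n₂} (A₁ P₁ Q₁ : Subset n₁) (A₂ P₂ Q₂ : Subset n₂) →
        ((A₁ ++ A₂) ─ (P₁ ++ P₂)) ∪ (Q₁ ++ Q₂) ≡ ((A₁ ─ P₁) ∪ Q₁) ++ ((A₂ ─ P₂) ∪ Q₂)
─∪-++ A₁ P₁ Q₁ A₂ P₂ Q₂ = begin
  ((A₁ ++ A₂) ─ (P₁ ++ P₂)) ∪ (Q₁ ++ Q₂)  ≡⟨ cong (_∪ (Q₁ ++ Q₂)) (zipWith-++ _ A₁ A₂ P₁ P₂) ⟩
  ((A₁ ─ P₁) ++ (A₂ ─ P₂)) ∪ (Q₁ ++ Q₂)   ≡⟨ zipWith-++ _ (A₁ ─ P₁) (A₂ ─ P₂) Q₁ Q₂ ⟩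
  ((A₁ ─ P₁) ∪ Q₁) ++ ((A₂ ─ P₂) ∪ Q₂)    ∎
  where open ≡-Reasoning

exchange : ∀ {n} → Subset n → Fin n → Fin n → Subset n
exchange S u v = (S ─ ⁅ u ⁆) ∪ ⁅ v ⁆

module _ {n₁ n₂} (A₁ : Subset n₁) (A₂ : Subset n₂) where

  exchange-++ : ∀ {u v} {P₁ Q₁ : Subset n₁} {P₂ Q₂ : Subset n₂} →
                ⁅ u ⁆ ≡ P₁ ++ P₂ → ⁅ v ⁆ ≡ Q₁ ++ Q₂ →
                exchange (A₁ ++ A₂) u v ≡ ((A₁ ─ P₁) ∪ Q₁) ++ ((A₂ ─ P₂) ∪ Q₂)
  exchange-++ {P₁ = P₁} {Q₁} {P₂} {Q₂} u≡ v≡ =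
    trans (cong₂ (λ P Q → ((A₁ ++ A₂) ─ P) ∪ Q) u≡ v≡) (─∪-++ A₁ P₁ Q₁ A₂ P₂ Q₂)

  exchange-↑ˡ↑ˡ : ∀ a b → exchange (A₁ ++ A₂) (a ↑ˡ n₂) (b ↑ˡ n₂) ≡ exchange A₁ a b ++ A₂
  exchange-↑ˡ↑ˡ a b = trans (exchange-++ (⁅↑ˡ⁆ a n₂) (⁅↑ˡ⁆ b n₂))
                            (cong (exchange A₁ a b ++_) (trans (∪-identityʳ _) (p─⊥≡p A₂)))

  exchange-↑ʳ↑ʳ : ∀ c d → exchange (A₁ ++ A₂) (n₁ ↑ʳ c) (n₁ ↑ʳ d) ≡ A₁ ++ exchange A₂ c d
  exchange-↑ʳ↑ʳ c d = trans (exchange-++ (⁅↑ʳ⁆ n₁ c) (⁅↑ʳ⁆ n₁ d))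
                            (cong (_++ exchange A₂ c d) (trans (∪-identityʳ _) (p─⊥≡p A₁)))

  exchange-↑ˡ↑ʳ : ∀ a d → exchange (A₁ ++ A₂) (a ↑ˡ n₂) (n₁ ↑ʳ d) ≡ (A₁ ─ ⁅ a ⁆) ++ (A₂ ∪ ⁅ d ⁆)
  exchange-↑ˡ↑ʳ a d = trans (exchange-++ (⁅↑ˡ⁆ a n₂) (⁅↑ʳ⁆ n₁ d))
                            (cong₂ _++_ (∪-identityʳ _) (cong (_∪ ⁅ d ⁆) (p─⊥≡p A₂)))

  exchange-↑ʳ↑ˡ : ∀ c b → exchange (A₁ ++ A₂) (n₁ ↑ʳ c) (b ↑ˡ n₂) ≡ (A₁ ∪ ⁅ b ⁆) ++ (A₂ ─ ⁅ c ⁆)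
  exchange-↑ʳ↑ˡ c b = trans (exchange-++ (⁅↑ʳ⁆ n₁ c) (⁅↑ˡ⁆ b n₂))
                            (cong₂ _++_ (cong (_∪ ⁅ b ⁆) (p─⊥≡p A₁)) (∪-identityʳ _))

⊆⊎∃∈∉ : ∀ {n} (p q : Subset n) → p ⊆ q ⊎ ∃[ a ] (a ∈ p × a ∉ q)
⊆⊎∃∈∉ p q with any? (λ a → a ∈? p ×-dec ¬? (a ∈? q))
... | yes witness = inj₂ witness
... | no ¬witness = inj₁ λ {a} a∈p → decidable-stable (a ∈? q) (λ a∉q → ¬witness (a , a∈p , a∉q))

data Split (n₁ n₂ : ℕ) : Fin (n₁ + n₂) → Set where
  inˡ : (a : Fin n₁) → Split n₁ n₂ (a ↑ˡ n₂)
  inʳ : (c : Fin n₂) → Split n₁ n₂ (n₁ ↑ʳ c)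

split : ∀ n₁ {n₂} (u : Fin (n₁ + n₂)) → Split n₁ n₂ u
split n₁ u with splitAt n₁ u in eq
... | inj₁ a = subst (Split n₁ _) (splitAt⁻¹-↑ˡ eq) (inˡ a)
... | inj₂ c = subst (Split n₁ _) (splitAt⁻¹-↑ʳ eq) (inʳ c)

DominatedBy : ∀ {n} → Graph n → Subset n → Fin n → Set
DominatedBy G S v = v ∈ S ⊎ ∃[ u ] (u ∈ S × G u v ≡ true)

module _ {n} {G : Graph n} where

  ⊆-dominated⇒≡ : ∀ {A B} → Independent G B → A ⊆ B → (∀ {v} → v ∈ B → DominatedBy G A v) → A ≡ B
  ⊆-dominated⇒≡ {A} {B} B-independent A⊆B dominated = ⊆-antisym A⊆B B⊆A
    where
    B⊆A : B ⊆ A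
    B⊆A v∈B with dominated v∈B
    ... | inj₁ v∈A            = v∈A
    ... | inj₂ (u , u∈A , uv) = ⊥-elim (not-¬ (B-independent _ _ (A⊆B u∈A) v∈B) uv)

  indDom-⊆⇒≡ : ∀ {A B} → IndDom G A → IndDom G B → A ⊆ B → A ≡ B
  indDom-⊆⇒≡ (_ , A-dominating) (B-independent , _) A⊆B =
    ⊆-dominated⇒≡ B-independent A⊆B (λ {v} _ → A-dominating v)

  isISet-≤ : ∀ {R S} → IsISet G R → IndDom G S → ∣ S ∣ ≤ ∣ R ∣ → IsISet G S
  isISet-≤ (_ , R-minimum) S-indDom S≤R = S-indDom , λ T T-indDom → ≤-trans S≤R (R-minimum T T-indDom)

module Glue {n₁ n₂} (G₁ : Graph n₁) (G₂ : Graph n₂) (X : Subset n₁) (Y : Subset n₂) where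

  joined : Fin n₁ → Fin n₂ → Bool
  joined a c = not (does (a ∈? X)) ∧ not (does (c ∈? Y))

  joined-∈ˡ : ∀ {a} → a ∈ X → ∀ c → joined a c ≡ false
  joined-∈ˡ {a} a∈X c rewrite dec-true (a ∈? X) a∈X = refl

  joined-∈ʳ : ∀ {c} → c ∈ Y → ∀ a → joined a c ≡ false
  joined-∈ʳ {c} c∈Y a rewrite dec-true (c ∈? Y) c∈Y = ∧-zeroʳ _

  joined-∉ : ∀ {a c} → a ∉ X → c ∉ Y → joined a c ≡ true
  joined-∉ {a} {c} a∉X c∉Y rewrite dec-false (a ∈? X) a∉X | dec-false (c ∈? Y) c∉Y = refl

  glue⊎ : Fin n₁ ⊎ Fin n₂ → Fin n₁ ⊎ Fin n₂ → Bool
  glue⊎ (inj₁ a) (inj₁ b) = G₁ a b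
  glue⊎ (inj₂ c) (inj₂ d) = G₂ c d
  glue⊎ (inj₁ a) (inj₂ d) = joined a d
  glue⊎ (inj₂ c) (inj₁ b) = joined b c

  glue : Graph (n₁ + n₂)
  glue u v = glue⊎ (splitAt n₁ u) (splitAt n₁ v)

  glue-simple : IsSimple G₁ → IsSimple G₂ → IsSimple glue
  glue-simple (G₁-symmetric , G₁-loopless) (G₂-symmetric , G₂-loopless) = symmetric , loopless
    where
    symmetric : ∀ u v → glue u v ≡ glue v u
    symmetric u v with splitAt n₁ u | splitAt n₁ v
    ... | inj₁ a | inj₁ b = G₁-symmetric a b
    ... | inj₂ c | inj₂ d = G₂-symmetric c d
    ... | inj₁ _ | inj₂ _ = refl
    ... | inj₂ _ | inj₁ _ = refl
    loopless : ∀ v → glue v v ≡ false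
    loopless v with splitAt n₁ v
    ... | inj₁ a = G₁-loopless a
    ... | inj₂ c = G₂-loopless c

  glue-ˡˡ : ∀ a b → glue (a ↑ˡ n₂) (b ↑ˡ n₂) ≡ G₁ a b
  glue-ˡˡ a b rewrite splitAt-↑ˡ n₁ a n₂ | splitAt-↑ˡ n₁ b n₂ = refl

  glue-ʳʳ : ∀ c d → glue (n₁ ↑ʳ c) (n₁ ↑ʳ d) ≡ G₂ c d
  glue-ʳʳ c d rewrite splitAt-↑ʳ n₁ n₂ c | splitAt-↑ʳ n₁ n₂ d = refl

  glue-ˡʳ : ∀ a d → glue (a ↑ˡ n₂) (n₁ ↑ʳ d) ≡ joined a d
  glue-ˡʳ a d rewrite splitAt-↑ˡ n₁ a n₂ | splitAt-↑ʳ n₁ n₂ d = refl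

  glue-ʳˡ : ∀ c b → glue (n₁ ↑ʳ c) (b ↑ˡ n₂) ≡ joined b c
  glue-ʳˡ c b rewrite splitAt-↑ʳ n₁ n₂ c | splitAt-↑ˡ n₁ b n₂ = refl

  module _ {T₁ : Subset n₁} {T₂ : Subset n₂} where

    independent-++⁻ˡ : Independent glue (T₁ ++ T₂) → Independent G₁ T₁
    independent-++⁻ˡ independent a b a∈T₁ b∈T₁ =
      trans (sym (glue-ˡˡ a b)) (independent _ _ (∈-++⁺ˡ a∈T₁) (∈-++⁺ˡ b∈T₁))

    independent-++⁻ʳ : Independent glue (T₁ ++ T₂) → Independent G₂ T₂
    independent-++⁻ʳ independent c d c∈T₂ d∈T₂ =
      trans (sym (glue-ʳʳ c d)) (independent _ _ (∈-++⁺ʳ c∈T₂) (∈-++⁺ʳ d∈T₂))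

    independent-++⁻-joined : Independent glue (T₁ ++ T₂) → ∀ {a c} → a ∈ T₁ → c ∈ T₂ → joined a c ≡ false
    independent-++⁻-joined independent {a} {c} a∈T₁ c∈T₂ =
      trans (sym (glue-ˡʳ a c)) (independent _ _ (∈-++⁺ˡ a∈T₁) (∈-++⁺ʳ c∈T₂))

    dominatedBy-++⁺ˡ : ∀ {a} → DominatedBy G₁ T₁ a → DominatedBy glue (T₁ ++ T₂) (a ↑ˡ n₂)
    dominatedBy-++⁺ˡ {a} = Sum.map ∈-++⁺ˡ λ (b , b∈T₁ , ba) → b ↑ˡ n₂ , ∈-++⁺ˡ b∈T₁ , trans (glue-ˡˡ b a) ba

    dominatedBy-++⁺ʳ : ∀ {c} → DominatedBy G₂ T₂ c → DominatedBy glue (T₁ ++ T₂) (n₁ ↑ʳ c)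
    dominatedBy-++⁺ʳ {c} = Sum.map ∈-++⁺ʳ λ (d , d∈T₂ , dc) → n₁ ↑ʳ d , ∈-++⁺ʳ d∈T₂ , trans (glue-ʳʳ d c) dc

    dominatedBy-++⁻ˡ : ∀ {a} → DominatedBy glue (T₁ ++ T₂) (a ↑ˡ n₂) →
                       (∀ {c} → c ∈ T₂ → joined a c ≡ false) → DominatedBy G₁ T₁ a
    dominatedBy-++⁻ˡ (inj₁ a∈T) _ = inj₁ (∈-++⁻ˡ a∈T)
    dominatedBy-++⁻ˡ {a} (inj₂ (u , u∈T , ua)) unjoined with split n₁ u
    ... | inˡ b = inj₂ (b , ∈-++⁻ˡ u∈T , trans (sym (glue-ˡˡ b a)) ua)
    ... | inʳ c = ⊥-elim (not-¬ (unjoined (∈-++⁻ʳ u∈T)) (trans (sym (glue-ʳˡ c a)) ua))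

    dominatedBy-++⁻ʳ : ∀ {c} → DominatedBy glue (T₁ ++ T₂) (n₁ ↑ʳ c) →
                       (∀ {a} → a ∈ T₁ → joined a c ≡ false) → DominatedBy G₂ T₂ c
    dominatedBy-++⁻ʳ (inj₁ c∈T) _ = inj₁ (∈-++⁻ʳ c∈T)
    dominatedBy-++⁻ʳ {c} (inj₂ (u , u∈T , uc)) unjoined with split n₁ u
    ... | inʳ d = inj₂ (d , ∈-++⁻ʳ u∈T , trans (sym (glue-ʳʳ d c)) uc)
    ... | inˡ a = ⊥-elim (not-¬ (unjoined (∈-++⁻ˡ u∈T)) (trans (sym (glue-ˡʳ a c)) uc))

  indDom-++⁺ : ∀ {S₁ S₂} → IndDom G₁ S₁ → IndDom G₂ S₂ →
               (∀ {a c} → a ∈ S₁ → c ∈ S₂ → joined a c ≡ false) → IndDom glue (S₁ ++ S₂)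
  indDom-++⁺ {S₁} {S₂} (S₁-independent , S₁-dominating) (S₂-independent , S₂-dominating) unjoined =
    independent , dominating
    where
    independent : Independent glue (S₁ ++ S₂)
    independent u v u∈S v∈S with split n₁ u | split n₁ v
    ... | inˡ a | inˡ b = trans (glue-ˡˡ a b) (S₁-independent a b (∈-++⁻ˡ u∈S) (∈-++⁻ˡ v∈S))
    ... | inʳ c | inʳ d = trans (glue-ʳʳ c d) (S₂-independent c d (∈-++⁻ʳ u∈S) (∈-++⁻ʳ v∈S))
    ... | inˡ a | inʳ d = trans (glue-ˡʳ a d) (unjoined (∈-++⁻ˡ u∈S) (∈-++⁻ʳ v∈S))
    ... | inʳ c | inˡ b = trans (glue-ʳˡ c b) (unjoined (∈-++⁻ˡ v∈S) (∈-++⁻ʳ u∈S))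
    dominating : Dominating glue (S₁ ++ S₂)
    dominating v with split n₁ v
    ... | inˡ a = dominatedBy-++⁺ˡ (S₁-dominating a)
    ... | inʳ c = dominatedBy-++⁺ʳ (S₂-dominating c)

  indDom-++Y : IndDom G₂ Y → ∀ {S₁} → IndDom G₁ S₁ → IndDom glue (S₁ ++ Y)
  indDom-++Y Y-indDom S₁-indDom = indDom-++⁺ S₁-indDom Y-indDom (λ {a} _ c∈Y → joined-∈ʳ c∈Y a)

  indDom-X++ : IndDom G₁ X → ∀ {S₂} → IndDom G₂ S₂ → IndDom glue (X ++ S₂)
  indDom-X++ X-indDom S₂-indDom = indDom-++⁺ X-indDom S₂-indDom (λ {_} {c} a∈X _ → joined-∈ˡ a∈X c)

  -- A vertex of T₁ outside X is joined to every vertex outside Y, so T₂ ⊆ Y; and X, Y receive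
  -- no joining edges, so T₁ ⊆ X resp. T₂ ⊆ Y already dominates all of X resp. Y.
  indDom-++⁻ : Independent G₁ X → Independent G₂ Y → ∀ T₁ T₂ → IndDom glue (T₁ ++ T₂) →
               (IndDom G₁ T₁ × T₂ ≡ Y) ⊎ (T₁ ≡ X × IndDom G₂ T₂)
  indDom-++⁻ X-independent Y-independent T₁ T₂ (independent , dominating) with ⊆⊎∃∈∉ T₁ X
  ... | inj₁ T₁⊆X = inj₂ (T₁≡X , independent-++⁻ʳ independent ,
                          λ c → dominatedBy-++⁻ʳ (dominating (n₁ ↑ʳ c)) λ a∈T₁ → joined-∈ˡ (T₁⊆X a∈T₁) c)
    where
    T₁≡X : T₁ ≡ X
    T₁≡X = ⊆-dominated⇒≡ X-independent T₁⊆X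
             (λ {a} a∈X → dominatedBy-++⁻ˡ (dominating (a ↑ˡ n₂)) λ {c} _ → joined-∈ˡ a∈X c)
  ... | inj₂ (a , a∈T₁ , a∉X) = inj₁ ((independent-++⁻ˡ independent ,
                                        λ b → dominatedBy-++⁻ˡ (dominating (b ↑ˡ n₂)) λ c∈T₂ → joined-∈ʳ (T₂⊆Y c∈T₂) b) , T₂≡Y)
    where
    T₂⊆Y : T₂ ⊆ Y
    T₂⊆Y {c} c∈T₂ = decidable-stable (c ∈? Y)
      (λ c∉Y → not-¬ (independent-++⁻-joined independent a∈T₁ c∈T₂) (joined-∉ a∉X c∉Y))
    T₂≡Y : T₂ ≡ Y
    T₂≡Y = ⊆-dominated⇒≡ Y-independent T₂⊆Y
             (λ {c} c∈Y → dominatedBy-++⁻ʳ (dominating (n₁ ↑ʳ c)) λ {a} _ → joined-∈ʳ c∈Y a)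

  module _ (X-iSet : IsISet G₁ X) (Y-iSet : IsISet G₂ Y) where

    X++Y-isISet : IsISet glue (X ++ Y)
    X++Y-isISet = indDom-++Y (proj₁ Y-iSet) (proj₁ X-iSet) , minimum
      where
      minimum : ∀ T → IndDom glue T → ∣ X ++ Y ∣ ≤ ∣ T ∣
      minimum T T-indDom with Vec.splitAt n₁ T
      ... | T₁ , T₂ , refl with indDom-++⁻ (proj₁ (proj₁ X-iSet)) (proj₁ (proj₁ Y-iSet)) T₁ T₂ T-indDom
      ... | inj₁ (T₁-indDom , refl) = ∣++∣-mono-≤ X T₁ Y Y (proj₂ X-iSet T₁ T₁-indDom) ≤-refl
      ... | inj₂ (refl , T₂-indDom) = ∣++∣-mono-≤ X X Y T₂ ≤-refl (proj₂ Y-iSet T₂ T₂-indDom)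

    isISet-++Y : ∀ {A₁} → IsISet G₁ A₁ → IsISet glue (A₁ ++ Y)
    isISet-++Y {A₁} (A₁-indDom , A₁-minimum) =
      isISet-≤ X++Y-isISet (indDom-++Y (proj₁ Y-iSet) A₁-indDom)
        (∣++∣-mono-≤ A₁ X Y Y (A₁-minimum X (proj₁ X-iSet)) ≤-refl)

    isISet-X++ : ∀ {A₂} → IsISet G₂ A₂ → IsISet glue (X ++ A₂)
    isISet-X++ {A₂} (A₂-indDom , A₂-minimum) =
      isISet-≤ X++Y-isISet (indDom-X++ (proj₁ X-iSet) A₂-indDom)
        (∣++∣-mono-≤ X X A₂ Y ≤-refl (A₂-minimum Y (proj₁ Y-iSet)))

  isISet-++Y⁻ : IndDom G₂ Y → ∀ {S₁} → IndDom G₁ S₁ → IsISet glue (S₁ ++ Y) → IsISet G₁ S₁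
  isISet-++Y⁻ Y-indDom {S₁} S₁-indDom (_ , S-minimum) =
    S₁-indDom , λ T₁ T₁-indDom → ∣++∣-cancelʳ-≤ S₁ T₁ Y (S-minimum (T₁ ++ Y) (indDom-++Y Y-indDom T₁-indDom))

  isISet-X++⁻ : IndDom G₁ X → ∀ {S₂} → IndDom G₂ S₂ → IsISet glue (X ++ S₂) → IsISet G₂ S₂
  isISet-X++⁻ X-indDom {S₂} S₂-indDom (_ , S-minimum) =
    S₂-indDom , λ T₂ T₂-indDom → ∣++∣-cancelˡ-≤ X S₂ T₂ (S-minimum (X ++ T₂) (indDom-X++ X-indDom T₂-indDom))

  adj-++⁺ˡ : ∀ {A₁ B₁} A₂ → ISetAdj G₁ A₁ B₁ → ISetAdj glue (A₁ ++ A₂) (B₁ ++ A₂)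
  adj-++⁺ˡ {A₁} {B₁} A₂ (A₁≢B₁ , a , b , ab , B₁≡) =
    A₁≢B₁ ∘ ++-injectiveˡ A₁ B₁ , a ↑ˡ n₂ , b ↑ˡ n₂ , trans (glue-ˡˡ a b) ab ,
    trans (cong (_++ A₂) B₁≡) (sym (exchange-↑ˡ↑ˡ A₁ A₂ a b))

  adj-++⁺ʳ : ∀ A₁ {A₂ B₂} → ISetAdj G₂ A₂ B₂ → ISetAdj glue (A₁ ++ A₂) (A₁ ++ B₂)
  adj-++⁺ʳ A₁ {A₂} (A₂≢B₂ , c , d , cd , B₂≡) =
    A₂≢B₂ ∘ ++-injectiveʳ A₁ A₁ , n₁ ↑ʳ c , n₁ ↑ʳ d , trans (glue-ʳʳ c d) cd ,
    trans (cong (A₁ ++_) B₂≡) (sym (exchange-↑ʳ↑ʳ A₁ A₂ c d))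

  module _ {A₁ B₁ : Subset n₁} {A₂ B₂ : Subset n₂} where

    -- An exchange across the two sides shrinks one side and enlarges the other; between
    -- independent dominating sets neither is possible without equality.
    adj-++⁻ : IndDom G₁ A₁ → IndDom G₁ B₁ → IndDom G₂ A₂ → IndDom G₂ B₂ →
              ISetAdj glue (A₁ ++ A₂) (B₁ ++ B₂) →
              (ISetAdj G₁ A₁ B₁ × A₂ ≡ B₂) ⊎ (A₁ ≡ B₁ × ISetAdj G₂ A₂ B₂)
    adj-++⁻ A₁-indDom B₁-indDom A₂-indDom B₂-indDom (A≢B , u , v , uv , B≡) with split n₁ u | split n₁ v
    ... | inˡ a | inˡ b =
      inj₁ ((A₁≢B₁ , a , b , trans (sym (glue-ˡˡ a b)) uv , ++-injectiveˡ B₁ _ B≡′) , A₂≡B₂)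
      where
      B≡′ : B₁ ++ B₂ ≡ exchange A₁ a b ++ A₂
      B≡′ = trans B≡ (exchange-↑ˡ↑ˡ A₁ A₂ a b)
      A₂≡B₂ : A₂ ≡ B₂
      A₂≡B₂ = sym (++-injectiveʳ B₁ _ B≡′)
      A₁≢B₁ : A₁ ≢ B₁
      A₁≢B₁ = λ A₁≡B₁ → A≢B (cong₂ _++_ A₁≡B₁ A₂≡B₂)
    ... | inʳ c | inʳ d =
      inj₂ (A₁≡B₁ , A₂≢B₂ , c , d , trans (sym (glue-ʳʳ c d)) uv , ++-injectiveʳ B₁ _ B≡′)
      where
      B≡′ : B₁ ++ B₂ ≡ A₁ ++ exchange A₂ c d
      B≡′ = trans B≡ (exchange-↑ʳ↑ʳ A₁ A₂ c d)
      A₁≡B₁ : A₁ ≡ B₁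
      A₁≡B₁ = sym (++-injectiveˡ B₁ _ B≡′)
      A₂≢B₂ : A₂ ≢ B₂
      A₂≢B₂ = λ A₂≡B₂ → A≢B (cong₂ _++_ A₁≡B₁ A₂≡B₂)
    ... | inˡ a | inʳ d = ⊥-elim (A≢B (cong₂ _++_ (sym B₁≡A₁) A₂≡B₂))
      where
      B≡′ : B₁ ++ B₂ ≡ (A₁ ─ ⁅ a ⁆) ++ (A₂ ∪ ⁅ d ⁆)
      B≡′ = trans B≡ (exchange-↑ˡ↑ʳ A₁ A₂ a d)
      B₁≡A₁ : B₁ ≡ A₁
      B₁≡A₁ = indDom-⊆⇒≡ B₁-indDom A₁-indDom
                (subst (_⊆ A₁) (sym (++-injectiveˡ B₁ _ B≡′)) (p─q⊆p A₁ ⁅ a ⁆))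
      A₂≡B₂ : A₂ ≡ B₂
      A₂≡B₂ = indDom-⊆⇒≡ A₂-indDom B₂-indDom
                (subst (A₂ ⊆_) (sym (++-injectiveʳ B₁ _ B≡′)) (p⊆p∪q ⁅ d ⁆))
    ... | inʳ c | inˡ b = ⊥-elim (A≢B (cong₂ _++_ A₁≡B₁ (sym B₂≡A₂)))
      where
      B≡′ : B₁ ++ B₂ ≡ (A₁ ∪ ⁅ b ⁆) ++ (A₂ ─ ⁅ c ⁆)
      B≡′ = trans B≡ (exchange-↑ʳ↑ˡ A₁ A₂ c b)
      A₁≡B₁ : A₁ ≡ B₁
      A₁≡B₁ = indDom-⊆⇒≡ A₁-indDom B₁-indDom
                (subst (A₁ ⊆_) (sym (++-injectiveˡ B₁ _ B≡′)) (p⊆p∪q ⁅ b ⁆))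
      B₂≡A₂ : B₂ ≡ A₂
      B₂≡A₂ = indDom-⊆⇒≡ B₂-indDom A₂-indDom
                (subst (_⊆ A₂) (sym (++-injectiveʳ B₁ _ B≡′)) (p─q⊆p A₂ ⁅ c ⁆))

    adj-++⁻ˡ : IndDom G₁ A₁ → IndDom G₁ B₁ → IndDom G₂ A₂ → IndDom G₂ B₂ →
               A₂ ≡ B₂ → ISetAdj glue (A₁ ++ A₂) (B₁ ++ B₂) → ISetAdj G₁ A₁ B₁
    adj-++⁻ˡ A₁-indDom B₁-indDom A₂-indDom B₂-indDom A₂≡B₂ adj
      with adj-++⁻ A₁-indDom B₁-indDom A₂-indDom B₂-indDom adj
    ... | inj₁ (adj₁ , _)      = adj₁
    ... | inj₂ (_ , A₂≢B₂ , _) = ⊥-elim (A₂≢B₂ A₂≡B₂)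

    adj-++⁻ʳ : IndDom G₁ A₁ → IndDom G₁ B₁ → IndDom G₂ A₂ → IndDom G₂ B₂ →
               A₁ ≡ B₁ → ISetAdj glue (A₁ ++ A₂) (B₁ ++ B₂) → ISetAdj G₂ A₂ B₂
    adj-++⁻ʳ A₁-indDom B₁-indDom A₂-indDom B₂-indDom A₁≡B₁ adj
      with adj-++⁻ A₁-indDom B₁-indDom A₂-indDom B₂-indDom adj
    ... | inj₁ ((A₁≢B₁ , _) , _) = ⊥-elim (A₁≢B₁ A₁≡B₁)
    ... | inj₂ (_ , adj₂)        = adj₂

    ¬adj-++ : IndDom G₁ A₁ → IndDom G₁ B₁ → IndDom G₂ A₂ → IndDom G₂ B₂ →
              A₁ ≢ B₁ → A₂ ≢ B₂ → ¬ ISetAdj glue (A₁ ++ A₂) (B₁ ++ B₂)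
    ¬adj-++ A₁-indDom B₁-indDom A₂-indDom B₂-indDom A₁≢B₁ A₂≢B₂ adj
      with adj-++⁻ A₁-indDom B₁-indDom A₂-indDom B₂-indDom adj
    ... | inj₁ (_ , A₂≡B₂) = A₂≢B₂ A₂≡B₂
    ... | inj₂ (A₁≡B₁ , _) = A₁≢B₁ A₁≡B₁

module Realization {m n} {H : Graph m} {G : Graph n} (ρ : IsoToIGraph H G) where

  iSet : Fin m → Subset n
  iSet = proj₁ ρ

  iSet-isISet : ∀ v → IsISet G (iSet v)
  iSet-isISet = proj₁ (proj₂ ρ)

  iSet-indDom : ∀ v → IndDom G (iSet v)
  iSet-indDom v = proj₁ (iSet-isISet v)

  iSet-injective : ∀ {u v} → iSet u ≡ iSet v → u ≡ v
  iSet-injective = proj₁ (proj₂ (proj₂ ρ))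

  iSet-surjective : ∀ S → IsISet G S → ∃[ v ] (iSet v ≡ S)
  iSet-surjective = proj₁ (proj₂ (proj₂ (proj₂ ρ)))

  iSet-adjacent : ∀ u v → (H u v ≡ true → ISetAdj G (iSet u) (iSet v)) × (ISetAdj G (iSet u) (iSet v) → H u v ≡ true)
  iSet-adjacent = proj₂ (proj₂ (proj₂ (proj₂ ρ)))

module Identification {m k n₁ n₂} {H₁ : Graph m} {H₂ : Graph (suc k)} {G₁ : Graph n₁} {G₂ : Graph n₂}
                      (x : Fin m) (y : Fin (suc k)) (ρ₁ : IsoToIGraph H₁ G₁) (ρ₂ : IsoToIGraph H₂ G₂) where

  private
    module R₁ = Realization ρ₁
    module R₂ = Realization ρ₂

  X : Subset n₁
  X = R₁.iSet x

  Y : Subset n₂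
  Y = R₂.iSet y

  open Glue G₁ G₂ X Y public

  realizeˡ : Fin m → Subset (n₁ + n₂)
  realizeˡ a = R₁.iSet a ++ Y

  realizeʳ : Fin (suc k) → Subset (n₁ + n₂)
  realizeʳ c = X ++ R₂.iSet c

  realize⊎ : Fin m ⊎ Fin k → Subset (n₁ + n₂)
  realize⊎ = [ realizeˡ , realizeʳ ∘ punchIn y ]′

  realize : Fin (m + k) → Subset (n₁ + n₂)
  realize u = realize⊎ (splitAt m u)

  realize-isISet : ∀ u → IsISet glue (realize u)
  realize-isISet u with splitAt m u
  ... | inj₁ a = isISet-++Y (R₁.iSet-isISet x) (R₂.iSet-isISet y) (R₁.iSet-isISet a)
  ... | inj₂ c = isISet-X++ (R₁.iSet-isISet x) (R₂.iSet-isISet y) (R₂.iSet-isISet (punchIn y c))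

  realize⊎-injective : ∀ p q → realize⊎ p ≡ realize⊎ q → p ≡ q
  realize⊎-injective (inj₁ a) (inj₁ b) e = cong inj₁ (R₁.iSet-injective (++-injectiveˡ _ _ e))
  realize⊎-injective (inj₂ c) (inj₂ d) e =
    cong inj₂ (punchIn-injective y c d (R₂.iSet-injective (++-injectiveʳ X X e)))
  realize⊎-injective (inj₁ a) (inj₂ c) e = ⊥-elim (punchInᵢ≢i y c (sym (R₂.iSet-injective (++-injectiveʳ _ X e))))
  realize⊎-injective (inj₂ c) (inj₁ a) e = ⊥-elim (punchInᵢ≢i y c (R₂.iSet-injective (++-injectiveʳ X _ e)))

  realize-injective : ∀ {u v} → realize u ≡ realize v → u ≡ v
  realize-injective {u} {v} e = begin
    u                       ≡⟨ join-splitAt m k u ⟨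
    join m k (splitAt m u)  ≡⟨ cong (join m k) (realize⊎-injective (splitAt m u) (splitAt m v) e) ⟩
    join m k (splitAt m v)  ≡⟨ join-splitAt m k v ⟩
    v                       ∎
    where open ≡-Reasoning

  realizeˡ-covered : ∀ a → ∃[ u ] (realize u ≡ realizeˡ a)
  realizeˡ-covered a = a ↑ˡ k , cong realize⊎ (splitAt-↑ˡ m a k)

  realizeʳ-covered : ∀ c → ∃[ u ] (realize u ≡ realizeʳ c)
  realizeʳ-covered c with y ≟ c
  ... | yes refl = realizeˡ-covered x
  ... | no y≢c   = m ↑ʳ punchOut y≢c ,
                   trans (cong realize⊎ (splitAt-↑ʳ m k _)) (cong realizeʳ (punchIn-punchOut y≢c))

  glue-iSets : ∀ S → IsISet glue S → (∃[ a ] (realizeˡ a ≡ S)) ⊎ (∃[ c ] (realizeʳ c ≡ S))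
  glue-iSets S S-iSet with Vec.splitAt n₁ S
  ... | S₁ , S₂ , refl with indDom-++⁻ (proj₁ (R₁.iSet-indDom x)) (proj₁ (R₂.iSet-indDom y)) S₁ S₂ (proj₁ S-iSet)
  ... | inj₁ (S₁-indDom , refl) =
    inj₁ (Product.map₂ (cong (_++ Y)) (R₁.iSet-surjective S₁ (isISet-++Y⁻ (R₂.iSet-indDom y) S₁-indDom S-iSet)))
  ... | inj₂ (refl , S₂-indDom) =
    inj₂ (Product.map₂ (cong (X ++_)) (R₂.iSet-surjective S₂ (isISet-X++⁻ (R₁.iSet-indDom x) S₂-indDom S-iSet)))

  realize-surjective : ∀ S → IsISet glue S → ∃[ u ] (realize u ≡ S)
  realize-surjective S S-iSet with glue-iSets S S-iSet
  ... | inj₁ (a , refl) = realizeˡ-covered a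
  ... | inj₂ (c , refl) = realizeʳ-covered c

  adjacentˡ : ∀ a b → (H₁ a b ≡ true → ISetAdj glue (realizeˡ a) (realizeˡ b))
                    × (ISetAdj glue (realizeˡ a) (realizeˡ b) → H₁ a b ≡ true)
  adjacentˡ a b =
    adj-++⁺ˡ Y ∘ proj₁ (R₁.iSet-adjacent a b) ,
    proj₂ (R₁.iSet-adjacent a b) ∘
      adj-++⁻ˡ (R₁.iSet-indDom a) (R₁.iSet-indDom b) (R₂.iSet-indDom y) (R₂.iSet-indDom y) refl

  adjacentʳ : ∀ c d → (H₂ c d ≡ true → ISetAdj glue (realizeʳ c) (realizeʳ d))
                    × (ISetAdj glue (realizeʳ c) (realizeʳ d) → H₂ c d ≡ true)
  adjacentʳ c d =
    adj-++⁺ʳ X ∘ proj₁ (R₂.iSet-adjacent c d) ,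
    proj₂ (R₂.iSet-adjacent c d) ∘
      adj-++⁻ʳ (R₁.iSet-indDom x) (R₁.iSet-indDom x) (R₂.iSet-indDom c) (R₂.iSet-indDom d) refl

  ¬adjacentˡʳ : ∀ {a c} → a ≢ x → c ≢ y → ¬ ISetAdj glue (realizeˡ a) (realizeʳ c)
  ¬adjacentˡʳ {a} {c} a≢x c≢y =
    ¬adj-++ (R₁.iSet-indDom a) (R₁.iSet-indDom x) (R₂.iSet-indDom y) (R₂.iSet-indDom c)
      (a≢x ∘ R₁.iSet-injective) (c≢y ∘ sym ∘ R₂.iSet-injective)

  ¬adjacentʳˡ : ∀ {c a} → c ≢ y → a ≢ x → ¬ ISetAdj glue (realizeʳ c) (realizeˡ a)
  ¬adjacentʳˡ {c} {a} c≢y a≢x =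
    ¬adj-++ (R₁.iSet-indDom x) (R₁.iSet-indDom a) (R₂.iSet-indDom c) (R₂.iSet-indDom y)
      (a≢x ∘ sym ∘ R₁.iSet-injective) (c≢y ∘ R₂.iSet-injective)

  -- realizeˡ x and realizeʳ y are both X ++ Y, which makes the cases u = x, v ∈ H₂ and
  -- u ∈ H₂, v = x instances of adjacentʳ.
  realize-adjacent : ∀ u v → (identify H₁ H₂ x y u v ≡ true → ISetAdj glue (realize u) (realize v))
                           × (ISetAdj glue (realize u) (realize v) → identify H₁ H₂ x y u v ≡ true)
  realize-adjacent u v with splitAt m u | splitAt m v
  ... | inj₁ a | inj₁ b = adjacentˡ a b
  ... | inj₂ c | inj₂ d = adjacentʳ (punchIn y c) (punchIn y d)
  ... | inj₁ a | inj₂ d with a ≟ x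
  ...   | yes refl = adjacentʳ y (punchIn y d)
  ...   | no a≢x   = (λ ()) , ⊥-elim ∘ ¬adjacentˡʳ a≢x (punchInᵢ≢i y d)
  realize-adjacent u v | inj₂ c | inj₁ b with b ≟ x
  ...   | yes refl = adjacentʳ (punchIn y c) y
  ...   | no b≢x   = (λ ()) , ⊥-elim ∘ ¬adjacentʳˡ (punchInᵢ≢i y c) b≢x

proposition5p6 : ∀ {m k} (H₁ : Graph m) (H₂ : Graph (suc k)) (x : Fin m) (y : Fin (suc k))
                 → IsSimple H₁ → IsSimple H₂
                 → IGraphRealizable H₁ → IGraphRealizable H₂
                 → IGraphRealizable (identify H₁ H₂ x y)
proposition5p6 H₁ H₂ x y _ _ (n₁ , G₁ , G₁-simple , ρ₁) (n₂ , G₂ , G₂-simple , ρ₂) =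
  n₁ + n₂ , glue , glue-simple G₁-simple G₂-simple ,
  realize , realize-isISet , realize-injective , realize-surjective , realize-adjacent
  where open Identification x y ρ₁ ρ₂
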